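{- Let $n\ge1$, let $C$ be a corner-sum hypermatrix of order $n$, and let $A=\Xi^{ -1}(C)$. For $i,j\in[n]$ let $m_{ij}=\min(i,j,n-i+1,n-j+1)$. Then for all $i,j,k\in[n]$, each of the three partial line sums \[\sum_{x=1}^kA_{i,j,x},\qquad\sum_{x=1}^kA_{i,x,j},\qquad\sum_{x=1}^kA_{x,i,j}\] lies between $1-m_{ij}$ and $m_{ij}$ (inclusive).
   Context: A corner-sum hypermatrix of order $n$ is an integer array $C$ indexed by $[0,n]^3$ with $C_{i,j,0}=C_{i,0,j}=C_{0,i,j}=0$, $C_{i,j,n}=C_{i,n,j}=C_{n,i,j}=ij$ for all $i,j\in[0,n]$, and for all $i,j\in[0,n]$, $1\le k\le n$, each of $C_{i,j,k}-C_{i,j,k-1}$, $C_{i,k,j}-C_{i,k-1,j}$, $C_{k,i,j}-C_{k-1,i,j}$ in $\{\max(0,i+j-n),\dots,\min(i,j)\}$. $\Xi^{ -1}(C)$ is the $n\times n\times n$ hypermatrix with $\Xi^{ -1}(C)_{i,j,k}=C_{i,j,k}-C_{i-1,j,k}-C_{i,j-1,k}-C_{i,j,k-1}+C_{i-1,j-1,k}+C_{i-1,j,k-1}+C_{i,j-1,k-1}-C_{i-1,j-1,k-1}$. -}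

module Defs where

open import Data.Nat as ℕ using (ℕ; zero; suc; _∸_; _⊓_)
open import Data.Integer as ℤ using (ℤ; +_)
open import Data.Product using (_×_)
open import Relation.Binary.PropositionalEquality using (_≡_)

-- Value range {max(0,i+j-n), ..., min(i,j)} as a predicate on integers.
-- max(0, i+j-n) = (i+j) ∸ n on naturals.
InRange : ℕ → ℕ → ℕ → ℤ → Set
InRange n i j v = (+ ((i ℕ.+ j) ∸ n)) ℤ.≤ v × v ℤ.≤ (+ (i ⊓ j))

-- A corner-sum hypermatrix of order n: an integer array indexed by [0,n]^3
-- (represented as a function on ℕ³; only entries with indices ≤ n matter).
record IsCornerSum (n : ℕ) (C : ℕ → ℕ → ℕ → ℤ) : Set where
  field
    zero₃ : ∀ i j → i ℕ.≤ n → j ℕ.≤ n → C i j 0 ≡ + 0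
    zero₂ : ∀ i j → i ℕ.≤ n → j ℕ.≤ n → C i 0 j ≡ + 0
    zero₁ : ∀ i j → i ℕ.≤ n → j ℕ.≤ n → C 0 i j ≡ + 0
    full₃ : ∀ i j → i ℕ.≤ n → j ℕ.≤ n → C i j n ≡ + (i ℕ.* j)
    full₂ : ∀ i j → i ℕ.≤ n → j ℕ.≤ n → C i n j ≡ + (i ℕ.* j)
    full₁ : ∀ i j → i ℕ.≤ n → j ℕ.≤ n → C n i j ≡ + (i ℕ.* j)
    step₃ : ∀ i j k → i ℕ.≤ n → j ℕ.≤ n → 1 ℕ.≤ k → k ℕ.≤ n →
              InRange n i j (C i j k ℤ.- C i j (k ∸ 1))
    step₂ : ∀ i j k → i ℕ.≤ n → j ℕ.≤ n → 1 ℕ.≤ k → k ℕ.≤ n →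
              InRange n i j (C i k j ℤ.- C i (k ∸ 1) j)
    step₁ : ∀ i j k → i ℕ.≤ n → j ℕ.≤ n → 1 ℕ.≤ k → k ℕ.≤ n →
              InRange n i j (C k i j ℤ.- C (k ∸ 1) i j)

Xi⁻¹ : (ℕ → ℕ → ℕ → ℤ) → ℕ → ℕ → ℕ → ℤ
Xi⁻¹ C i j k =
  C i j k ℤ.- C (i ∸ 1) j k ℤ.- C i (j ∸ 1) k ℤ.- C i j (k ∸ 1)
  ℤ.+ C (i ∸ 1) (j ∸ 1) k ℤ.+ C (i ∸ 1) j (k ∸ 1) ℤ.+ C i (j ∸ 1) (k ∸ 1)
  ℤ.- C (i ∸ 1) (j ∸ 1) (k ∸ 1)

sumTo : ℕ → (ℕ → ℤ) → ℤ
sumTo zero    f = + 0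
sumTo (suc k) f = sumTo k f ℤ.+ f (suc k)

m : ℕ → ℕ → ℕ → ℕ
m n i j = i ⊓ j ⊓ (suc n ∸ i) ⊓ (suc n ∸ j)

Between : ℕ → ℤ → Set
Between μ v = (+ 1 ℤ.- + μ) ℤ.≤ v × v ℤ.≤ + μ

-- Σ_{x=1}^k A_{i,j,x} telescopes to the mixed difference
--   C(i,j,k) − C(i−1,j,k) − C(i,j−1,k) + C(i−1,j−1,k),
-- which splits in two ways as a difference of two consecutive steps of C along one
-- coordinate. Comparing the allowed ranges of two such steps at levels i and i − 1
-- bounds the difference by 1 − min(i, n+1−i) and min(i, n+1−i); the two splittings
-- give this for i and for j. The other two directions follow by rotating coordinates.
module Submission where

open import Defs
open import Data.Nat using (ℕ; _≤_)
open import Data.Integer using (ℤ)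
open import Data.Product using (_×_)

open import Data.Nat as ℕ using (suc; _∸_; _⊓_; z≤n)
import Data.Nat.Properties as ℕP
open import Algebra.Properties.CommutativeSemigroup ℕP.⊓-commutativeSemigroup using (interchange)
open import Data.Integer as ℤ using (+_; _+_; _-_)
import Data.Integer.Properties as ℤP
open import Data.Integer.Tactic.RingSolver using (solve-∀)
open import Data.Product using (_,_; proj₁; proj₂)
open import Data.Sum using (inj₁; inj₂)
open import Relation.Binary.PropositionalEquality

-‿mono-≤ : ∀ {a b c d} → a ℤ.≤ b → c ℤ.≤ d → a - d ℤ.≤ b - c
-‿mono-≤ a≤b c≤d = ℤP.+-mono-≤ a≤b (ℤP.neg-mono-≤ c≤d)

[+m]-[+n]≤+[m∸n] : ∀ m n → + m - + n ℤ.≤ + (m ∸ n)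
[+m]-[+n]≤+[m∸n] m n with ℕP.≤-total n m
... | inj₁ n≤m = ℤP.≤-reflexive (trans (ℤP.m-n≡m⊖n m n) (ℤP.⊖-≥ n≤m))
... | inj₂ m≤n = ℤP.≤-trans (ℤP.≤-reflexive (trans (ℤP.m-n≡m⊖n m n) (ℤP.⊖-≤ m≤n))) ℤP.neg-≤-pos

Between-⊓ : ∀ {μ ν v} → Between μ v → Between ν v → Between (μ ⊓ ν) v
Between-⊓ {μ} {ν} μ-bound ν-bound with ℕP.⊓-sel μ ν
... | inj₁ μ⊓ν≡μ rewrite μ⊓ν≡μ = μ-bound
... | inj₂ μ⊓ν≡ν rewrite μ⊓ν≡ν = ν-bound

module InRangeBounds {n i k : ℕ} {v : ℤ} (v∈ : InRange n i k v) where

  0≤ : + 0 ℤ.≤ v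
  0≤ = ℤP.≤-trans (ℤ.+≤+ z≤n) (proj₁ v∈)

  ≤ˡ : v ℤ.≤ + i
  ≤ˡ = ℤP.≤-trans (proj₂ v∈) (ℤ.+≤+ (ℕP.m⊓n≤m i k))

  ≤ʳ : v ℤ.≤ + k
  ≤ʳ = ℤP.≤-trans (proj₂ v∈) (ℤ.+≤+ (ℕP.m⊓n≤n i k))

  ≥ : + i + + k - + n ℤ.≤ v
  ≥ = ℤP.≤-trans ([+m]-[+n]≤+[m∸n] (i ℕ.+ k) n) (proj₁ v∈)

distanceToEdge : ℕ → ℕ → ℕ
distanceToEdge n i = i ⊓ (suc n ∸ i)

InRange-difference : ∀ {n i k a b} → InRange n (suc i) k a → InRange n i k b →
  Between (distanceToEdge n (suc i)) (a - b)
InRange-difference {n} {i} {k} {a} {b} a∈ b∈ =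
  Between-⊓ (lower-by-level , upper-by-level) (lower-by-edge , upper-by-edge)
  where
  open ℤP.≤-Reasoning
  module a = InRangeBounds {n} a∈
  module b = InRangeBounds {n} b∈

  upper-by-level : a - b ℤ.≤ + suc i
  upper-by-level = begin
    a - b          ≤⟨ -‿mono-≤ a.≤ˡ b.0≤ ⟩
    + suc i - + 0  ≡⟨ ℤP.+-identityʳ (+ suc i) ⟩
    + suc i        ∎

  lower-by-level : + 1 - + suc i ℤ.≤ a - b
  lower-by-level = begin
    + 1 - + suc i  ≡⟨ shift (+ i) ⟩
    + 0 - + i      ≤⟨ -‿mono-≤ a.0≤ b.≤ˡ ⟩
    a - b          ∎
    where
    shift : ∀ x → + 1 - (+ 1 + x) ≡ + 0 - x
    shift = solve-∀

  upper-by-edge : a - b ℤ.≤ + (n ∸ i)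
  upper-by-edge = begin
    a - b                    ≤⟨ -‿mono-≤ a.≤ʳ b.≥ ⟩
    + k - (+ i + + k - + n)  ≡⟨ cancel (+ i) (+ k) (+ n) ⟩
    + n - + i                ≤⟨ [+m]-[+n]≤+[m∸n] n i ⟩
    + (n ∸ i)                ∎
    where
    cancel : ∀ x y z → y - (x + y - z) ≡ z - x
    cancel = solve-∀

  lower-by-edge : + 1 - + (n ∸ i) ℤ.≤ a - b
  lower-by-edge = begin
    + 1 - + (n ∸ i)                    ≤⟨ ℤP.+-monoʳ-≤ (+ 1) (ℤP.neg-mono-≤ ([+m]-[+n]≤+[m∸n] n i)) ⟩
    + 1 - (+ n - + i)                  ≡⟨ cancel (+ i) (+ k) (+ n) ⟩
    (+ suc i + + k - + n) - + k        ≤⟨ -‿mono-≤ a.≥ b.≤ʳ ⟩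
    a - b                              ∎
    where
    cancel : ∀ x y z → + 1 - (z - x) ≡ (+ 1 + x + y - z) - y
    cancel = solve-∀

InRange-sym : ∀ {n i j v} → InRange n i j v → InRange n j i v
InRange-sym {n} {i} {j} (lower , upper)
  rewrite ℕP.+-comm i j | ℕP.⊓-comm i j = lower , upper

m≡distanceToEdge-⊓ : ∀ n i j → m n i j ≡ distanceToEdge n i ⊓ distanceToEdge n j
m≡distanceToEdge-⊓ n i j = trans (ℕP.⊓-assoc (i ⊓ j) (suc n ∸ i) (suc n ∸ j))
                                 (interchange i j (suc n ∸ i) (suc n ∸ j))

m-comm : ∀ n i j → m n i j ≡ m n j i
m-comm n i j = begin
  m n i j                                        ≡⟨ m≡distanceToEdge-⊓ n i j ⟩
  distanceToEdge n i ⊓ distanceToEdge n j        ≡⟨ ℕP.⊓-comm (distanceToEdge n i) _ ⟩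
  distanceToEdge n j ⊓ distanceToEdge n i        ≡⟨ m≡distanceToEdge-⊓ n j i ⟨
  m n j i                                        ∎
  where open ≡-Reasoning

sumTo-cong : ∀ {f g : ℕ → ℤ} → (∀ x → f x ≡ g x) → ∀ k → sumTo k f ≡ sumTo k g
sumTo-cong f≗g ℕ.zero  = refl
sumTo-cong f≗g (suc k) = cong₂ _+_ (sumTo-cong f≗g k) (f≗g (suc k))

sumTo-telescope : ∀ {f : ℕ → ℤ} (g : ℕ → ℤ) → (∀ x → f (suc x) ≡ g (suc x) - g x) →
  ∀ k → sumTo k f ≡ g k - g 0
sumTo-telescope g f≡Δg ℕ.zero  = sym (ℤP.+-inverseʳ (g 0))
sumTo-telescope g f≡Δg (suc k) =
  trans (cong₂ _+_ (sumTo-telescope g f≡Δg k) (f≡Δg k)) (chain (g k) (g (suc k)) (g 0))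
  where
  chain : ∀ x y z → (x - z) + (y - x) ≡ y - z
  chain = solve-∀

Δ₁₂ : (ℕ → ℕ → ℕ → ℤ) → ℕ → ℕ → ℕ → ℤ
Δ₁₂ C i j k = C i j k - C (i ∸ 1) j k - C i (j ∸ 1) k + C (i ∸ 1) (j ∸ 1) k

Xi⁻¹≡Δ₁₂-step : ∀ C i j k → Xi⁻¹ C i j (suc k) ≡ Δ₁₂ C i j (suc k) - Δ₁₂ C i j k
Xi⁻¹≡Δ₁₂-step C i j k =
  regroup (C i j (suc k)) (C i′ j (suc k)) (C i j′ (suc k)) (C i′ j′ (suc k))
          (C i j k)       (C i′ j k)       (C i j′ k)       (C i′ j′ k)
  where
  i′ = i ∸ 1
  j′ = j ∸ 1
  regroup : ∀ a b c d e f g h →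
    a - b - c - e + d + f + g - h ≡ (a - b - c + d) - (e - f - g + h)
  regroup = solve-∀

rotate : (ℕ → ℕ → ℕ → ℤ) → ℕ → ℕ → ℕ → ℤ
rotate C i j k = C k i j

Xi⁻¹-rotate : ∀ C i j k → Xi⁻¹ (rotate C) i j k ≡ Xi⁻¹ C k i j
Xi⁻¹-rotate C i j k =
  reorder (C k i j) (C k i′ j) (C k i j′) (C k′ i j)
          (C k i′ j′) (C k′ i′ j) (C k′ i j′) (C k′ i′ j′)
  where
  i′ = i ∸ 1
  j′ = j ∸ 1
  k′ = k ∸ 1
  reorder : ∀ a b c d e f g h →
    a - b - c - d + e + f + g - h ≡ a - d - b - c + f + g + e - h
  reorder = solve-∀

IsCornerSum-rotate : ∀ {n C} → IsCornerSum n C → IsCornerSum n (rotate C)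
IsCornerSum-rotate {n} isCS = record
  { zero₃ = zero₁
  ; zero₂ = λ i j i≤n j≤n → zero₃ j i j≤n i≤n
  ; zero₁ = λ i j i≤n j≤n → zero₂ j i j≤n i≤n
  ; full₃ = full₁
  ; full₂ = λ i j i≤n j≤n → trans (full₃ j i j≤n i≤n) (cong +_ (ℕP.*-comm j i))
  ; full₁ = λ i j i≤n j≤n → trans (full₂ j i j≤n i≤n) (cong +_ (ℕP.*-comm j i))
  ; step₃ = step₁
  ; step₂ = λ i j k i≤n j≤n 1≤k k≤n → InRange-sym {n} (step₃ j i k j≤n i≤n 1≤k k≤n)
  ; step₁ = λ i j k i≤n j≤n 1≤k k≤n → InRange-sym {n} (step₂ j i k j≤n i≤n 1≤k k≤n)
  }
  where open IsCornerSum isCS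

module _ {n : ℕ} {C : ℕ → ℕ → ℕ → ℤ} (isCS : IsCornerSum n C) where
  open IsCornerSum isCS

  sumTo-Xi⁻¹≡Δ₁₂ : ∀ {i j} → i ≤ n → j ≤ n → ∀ k → sumTo k (Xi⁻¹ C i j) ≡ Δ₁₂ C i j k
  sumTo-Xi⁻¹≡Δ₁₂ {i} {j} i≤n j≤n k = begin
    sumTo k (Xi⁻¹ C i j)           ≡⟨ sumTo-telescope (Δ₁₂ C i j) (Xi⁻¹≡Δ₁₂-step C i j) k ⟩
    Δ₁₂ C i j k - Δ₁₂ C i j 0      ≡⟨ cong (λ z → Δ₁₂ C i j k - z) Δ₁₂-at-0 ⟩
    Δ₁₂ C i j k - + 0              ≡⟨ ℤP.+-identityʳ _ ⟩
    Δ₁₂ C i j k                    ∎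
    where
    open ≡-Reasoning
    i′≤n = ℕP.≤-trans (ℕP.m∸n≤m i 1) i≤n
    j′≤n = ℕP.≤-trans (ℕP.m∸n≤m j 1) j≤n
    Δ₁₂-at-0 : Δ₁₂ C i j 0 ≡ + 0
    Δ₁₂-at-0 rewrite zero₃ i j i≤n j≤n | zero₃ (i ∸ 1) j i′≤n j≤n
                   | zero₃ i (j ∸ 1) i≤n j′≤n | zero₃ (i ∸ 1) (j ∸ 1) i′≤n j′≤n = refl

  Δ₁₂-between : ∀ {i j k} → 1 ≤ i → i ≤ n → 1 ≤ j → j ≤ n → 1 ≤ k → k ≤ n →
    Between (m n i j) (Δ₁₂ C i j k)
  Δ₁₂-between {suc i′} {suc j′} {k} 1≤i i≤n 1≤j j≤n 1≤k k≤n =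
    subst (λ μ → Between μ (Δ₁₂ C i j k)) (sym (m≡distanceToEdge-⊓ n i j))
      (Between-⊓
        (subst (Between _) (sym (split-along₂ P Q R S))
          (InRange-difference (step₂ i k j i≤n k≤n 1≤j j≤n) (step₂ i′ k j i′≤n k≤n 1≤j j≤n)))
        (subst (Between _) (sym (split-along₁ P Q R S))
          (InRange-difference (step₁ j k i j≤n k≤n 1≤i i≤n) (step₁ j′ k i j′≤n k≤n 1≤i i≤n))))
    where
    i = suc i′
    j = suc j′
    i′≤n = ℕP.<⇒≤ i≤n
    j′≤n = ℕP.<⇒≤ j≤n
    P = C i j k
    Q = C i′ j k
    R = C i j′ k
    S = C i′ j′ k
    split-along₂ : ∀ p q r s → p - q - r + s ≡ (p - r) - (q - s)
    split-along₂ = solve-∀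
    split-along₁ : ∀ p q r s → p - q - r + s ≡ (p - q) - (r - s)
    split-along₁ = solve-∀

  lineSum₃-between : ∀ i j k → 1 ≤ i → i ≤ n → 1 ≤ j → j ≤ n → 1 ≤ k → k ≤ n →
    Between (m n i j) (sumTo k (Xi⁻¹ C i j))
  lineSum₃-between i j k 1≤i i≤n 1≤j j≤n 1≤k k≤n =
    subst (Between (m n i j)) (sym (sumTo-Xi⁻¹≡Δ₁₂ i≤n j≤n k))
      (Δ₁₂-between 1≤i i≤n 1≤j j≤n 1≤k k≤n)

mainTheorem19 : (n : ℕ) → 1 ≤ n → (C : ℕ → ℕ → ℕ → ℤ) → IsCornerSum n C →
    ∀ i j k → 1 ≤ i → i ≤ n → 1 ≤ j → j ≤ n → 1 ≤ k → k ≤ n →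
      Between (m n i j) (sumTo k (λ x → Xi⁻¹ C i j x))
      × Between (m n i j) (sumTo k (λ x → Xi⁻¹ C i x j))
      × Between (m n i j) (sumTo k (λ x → Xi⁻¹ C x i j))
mainTheorem19 n _ C isCS i j k 1≤i i≤n 1≤j j≤n 1≤k k≤n =
    lineSum₃-between isCS i j k 1≤i i≤n 1≤j j≤n 1≤k k≤n
  , subst₂ Between (m-comm n j i) (sumTo-cong (λ x → trans (Xi⁻¹-rotate (rotate C) j i x)
                                                             (Xi⁻¹-rotate C x j i)) k)
      (lineSum₃-between (IsCornerSum-rotate (IsCornerSum-rotate isCS)) j i k 1≤j j≤n 1≤i i≤n 1≤k k≤n)
  , subst (Between (m n i j)) (sumTo-cong (Xi⁻¹-rotate C i j) k)
      (lineSum₃-between (IsCornerSum-rotate isCS) i j k 1≤i i≤n 1≤j j≤n 1≤k k≤n)
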